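{- Let $\mathfrak{A}\in\mathrm{REL}$ be a perfect algebra and let $a,b,c$ be atoms of $\mathfrak{A}$ with $a\le b;c$. Then: (1) if $a\le1'$ then $b=\breve{c}$ and $c=\breve{b}$; (2) if $\breve{b}\neq0$ then $c\le\breve{b};a$; (3) if $\breve{c}\neq0$ then $b\le a;\breve{c}$; (4) if $\breve{a}\neq0$ and $\breve{b}\neq0$ then $\breve{b}\le c;\breve{a}$; (5) if $\breve{a}\neq0$ and $\breve{c}\neq0$ then $\breve{c}\le\breve{a};b$; (6) if $\breve{a}\neq0$, $\breve{b}\neq0$ and $\breve{c}\neq0$ then $\breve{a}\le\breve{c};\breve{b}$.
   Context: $\mathrm{REL}$ is the class of algebras $\mathfrak{A}=\langle A,+,\cdot,-,0,1,;,\breve{\ },1'\rangle$ (binary $;$, unary converse $x\mapsto\breve{x}$, constant $1'$) satisfying: (Ax1) $\langle A,+,\cdot,-,0,1\rangle$ is a Boolean algebra; (Ax2) $(x\cdot\breve{y})\breve{}=\breve{x}\cdot y$; (Ax3) $(x+y);z=x;z+y;z$ and $x;(y+z)=x;y+x;z$; (Ax4) $1;0=0$ and $0;1=0$; (Ax5) $(\breve{x};y)\cdot z=(\breve{x};(y\cdot(\breve{\breve{x}};z)))\cdot z$ and $(x;\breve{y})\cdot z=((x\cdot(z;\breve{\breve{y}}));\breve{y})\cdot z$; (Ax6) $1';x\le x$ and $x;1'\le x$; (Ax7) $1';1'=1'$; (Ax8) $(-(\breve{1});-(\breve{1}))\cdot 1'=0$; (Ax9) $((x\cdot1');y);z=(x\cdot1');(y;z)$,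 $(x;(y\cdot1'));z=x;((y\cdot1');z)$ and $(x;y);(z\cdot1')=x;(y;(z\cdot1'))$. An algebra $\mathfrak{A}\in\mathrm{REL}$ is perfect if it is complete and atomic and its converse and composition operations are completely additive. -}

module Defs where

open import Level using (Level; _⊔_) renaming (suc to lsuc)
open import Algebra.Lattice.Bundles using (BooleanAlgebra)
open import Data.Product using (Σ; ∃; _×_; _,_)
open import Data.Sum using (_⊎_)
open import Relation.Nullary using (¬_)
open import Relation.Unary using (Pred)

-- The class REL (non-involutive relation algebras, axioms Ax1-Ax9).
-- The Boolean reduct (Ax1) is a stdlib Boolean algebra over a setoid:
--   + is _∨_, · is _∧_, - is -_ (stdlib ¬_ renamed), 0 is ⊥, 1 is ⊤.
-- ';' is _⨾_, converse is postfix _˘, the identity constant 1' is 𝟏'.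
record REL (c ℓ : Level) : Set (lsuc (c ⊔ ℓ)) where
  infixl 9 _˘
  infixr 7.5 _⨾_
  field
    boolAlg : BooleanAlgebra c ℓ
  open BooleanAlgebra boolAlg public renaming (¬_ to -_)
  field
    _⨾_ : Carrier → Carrier → Carrier
    _˘  : Carrier → Carrier
    𝟏'  : Carrier
    ⨾-cong : ∀ {x x′ y y′} → x ≈ x′ → y ≈ y′ → (x ⨾ y) ≈ (x′ ⨾ y′)
    ˘-cong : ∀ {x x′} → x ≈ x′ → (x ˘) ≈ (x′ ˘)
    ax2 : ∀ x y → ((x ∧ y ˘) ˘) ≈ (x ˘ ∧ y)
    ax3ˡ : ∀ x y z → ((x ∨ y) ⨾ z) ≈ (x ⨾ z ∨ y ⨾ z)
    ax3ʳ : ∀ x y z → (x ⨾ (y ∨ z)) ≈ (x ⨾ y ∨ x ⨾ z)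
    ax4ˡ : (⊤ ⨾ ⊥) ≈ ⊥
    ax4ʳ : (⊥ ⨾ ⊤) ≈ ⊥
    ax5ˡ : ∀ x y z → ((x ˘ ⨾ y) ∧ z) ≈ ((x ˘ ⨾ (y ∧ (x ˘ ˘ ⨾ z))) ∧ z)
    ax5ʳ : ∀ x y z → ((x ⨾ y ˘) ∧ z) ≈ (((x ∧ (z ⨾ y ˘ ˘)) ⨾ y ˘) ∧ z)
    -- Ax6 (x ≤ y is x ∨ y = y)
    ax6ˡ : ∀ x → ((𝟏' ⨾ x) ∨ x) ≈ x
    ax6ʳ : ∀ x → ((x ⨾ 𝟏') ∨ x) ≈ x
    ax7 : (𝟏' ⨾ 𝟏') ≈ 𝟏'
    ax8 : (((- (⊤ ˘)) ⨾ (- (⊤ ˘))) ∧ 𝟏') ≈ ⊥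
    ax9a : ∀ x y z → (((x ∧ 𝟏') ⨾ y) ⨾ z) ≈ ((x ∧ 𝟏') ⨾ (y ⨾ z))
    ax9b : ∀ x y z → ((x ⨾ (y ∧ 𝟏')) ⨾ z) ≈ (x ⨾ ((y ∧ 𝟏') ⨾ z))
    ax9c : ∀ x y z → ((x ⨾ y) ⨾ (z ∧ 𝟏')) ≈ (x ⨾ (y ⨾ (z ∧ 𝟏')))

  infix 4 _≤_
  _≤_ : Carrier → Carrier → Set ℓ
  x ≤ y = (x ∨ y) ≈ y

  Atom : Carrier → Set (c ⊔ ℓ)
  Atom a = ¬ (a ≈ ⊥) × (∀ x → x ≤ a → (x ≈ ⊥) ⊎ (x ≈ a))

  Atomic : Set (c ⊔ ℓ)
  Atomic = ∀ x → ¬ (x ≈ ⊥) → ∃ λ a → Atom a × a ≤ x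

  IsLub : Pred Carrier (c ⊔ ℓ) → Carrier → Set (c ⊔ ℓ)
  IsLub S u = (∀ x → S x → x ≤ u) × (∀ v → (∀ x → S x → x ≤ v) → u ≤ v)

  Complete : Set (lsuc (c ⊔ ℓ))
  Complete = (S : Pred Carrier (c ⊔ ℓ)) → ∃ λ u → IsLub S u

  conv-img : Pred Carrier (c ⊔ ℓ) → Pred Carrier (c ⊔ ℓ)
  conv-img S y = ∃ λ x → S x × (y ≈ x ˘)

  compʳ-img : Pred Carrier (c ⊔ ℓ) → Carrier → Pred Carrier (c ⊔ ℓ)
  compʳ-img S z y = ∃ λ x → S x × (y ≈ (x ⨾ z))

  compˡ-img : Carrier → Pred Carrier (c ⊔ ℓ) → Pred Carrier (c ⊔ ℓ)
  compˡ-img z S y = ∃ λ x → S x × (y ≈ (z ⨾ x))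

  ConvCompletelyAdditive : Set (lsuc (c ⊔ ℓ))
  ConvCompletelyAdditive =
    ∀ (S : Pred Carrier (c ⊔ ℓ)) u → IsLub S u → IsLub (conv-img S) (u ˘)

  CompCompletelyAdditive : Set (lsuc (c ⊔ ℓ))
  CompCompletelyAdditive =
    (∀ (S : Pred Carrier (c ⊔ ℓ)) u z → IsLub S u → IsLub (compʳ-img S z) (u ⨾ z))
    × (∀ (S : Pred Carrier (c ⊔ ℓ)) u z → IsLub S u → IsLub (compˡ-img z S) (z ⨾ u))

  Perfect : Set (lsuc (c ⊔ ℓ))
  Perfect = Complete × Atomic × ConvCompletelyAdditive × CompCompletelyAdditive

-- Ax5 is a one-sided modular law (x ⨾ y) ∧ z ≈ (x ⨾ (y ∧ (x ˘ ⨾ z))) ∧ z, valid once x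
-- lies below ⊤ ˘ (where converse is involutive). For atoms y it yields the cycle law:
-- from z ≤ x ⨾ y with z ≠ ⊥ the meet y ∧ (x ˘ ⨾ z) cannot vanish, so y ≤ x ˘ ⨾ z.
-- An atom with non-zero converse lies below ⊤ ˘, and (by monotonicity of converse,
-- a consequence of perfection) its converse is again an atom below ⊤ ˘, so the cycle
-- law can be applied repeatedly to rotate a ≤ b ⨾ c into parts (2)-(6). For (1),
-- if neither b nor c is below ⊤ ˘, both lie below - (⊤ ˘) and Ax8 forces a ≈ ⊥.
module Submission where

open import Defs
open import Level using (Lift; lift)
open import Data.Product using (_×_; _,_; proj₁; swap)
open import Data.Sum using (_⊎_; inj₁; inj₂)
open import Data.Empty using (⊥-elim)
open import Relation.Nullary using (¬_)
open import Relation.Binary.Bundles using (Poset)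
open import Relation.Binary.Definitions using (Transitive; Antisymmetric)
open import Relation.Binary.Core using (_⇒_)

module Properties {o ℓ} (𝔄 : REL o ℓ) where
  open REL 𝔄
  open import Algebra.Lattice.Properties.BooleanAlgebra boolAlg
    using (∧-zeroˡ; ∧-zeroʳ; ∧-identityˡ; ∧-identityʳ; ∨-identityˡ; ∨-identityʳ; ∨-zeroʳ; ∨-idem)

  ≤-reflexive : _≈_ ⇒ _≤_
  ≤-reflexive {x} {y} x≈y = trans (∨-congʳ x≈y) (∨-idem y)

  ≤-trans : Transitive _≤_
  ≤-trans {x} {y} {z} x≤y y≤z =
    trans (∨-congˡ (sym y≤z)) (trans (sym (∨-assoc x y z)) (trans (∨-congʳ x≤y) y≤z))

  ≤-antisym : Antisymmetric _≈_ _≤_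
  ≤-antisym {x} {y} x≤y y≤x = trans (sym y≤x) (trans (∨-comm y x) x≤y)

  ≤-poset : Poset o ℓ ℓ
  ≤-poset = record
    { _≤_ = _≤_
    ; isPartialOrder = record
      { isPreorder = record
        { isEquivalence = isEquivalence ; reflexive = ≤-reflexive ; trans = ≤-trans }
      ; antisym = ≤-antisym
      }
    }

  open import Relation.Binary.Reasoning.PartialOrder ≤-poset

  x≤y⇒x∧y≈x : ∀ {x y} → x ≤ y → x ∧ y ≈ x
  x≤y⇒x∧y≈x {x} {y} x≤y = trans (∧-congˡ (sym x≤y)) (∧-absorbs-∨ x y)

  x∧y≈x⇒x≤y : ∀ {x y} → x ∧ y ≈ x → x ≤ y
  x∧y≈x⇒x≤y {x} {y} x∧y≈x = begin-equality
    x ∨ y        ≈⟨ ∨-congʳ x∧y≈x ⟨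
    x ∧ y ∨ y    ≈⟨ ∨-comm _ y ⟩
    y ∨ x ∧ y    ≈⟨ ∨-congˡ (∧-comm x y) ⟩
    y ∨ y ∧ x    ≈⟨ ∨-absorbs-∧ y x ⟩
    y            ∎

  x∧y≤x : ∀ {x y} → x ∧ y ≤ x
  x∧y≤x {x} {y} = trans (∨-comm _ x) (∨-absorbs-∧ x y)

  ∧-greatest : ∀ {x y z} → x ≤ y → x ≤ z → x ≤ y ∧ z
  ∧-greatest {x} {y} {z} x≤y x≤z = x∧y≈x⇒x≤y
    (trans (sym (∧-assoc x y z)) (trans (∧-congʳ (x≤y⇒x∧y≈x x≤y)) (x≤y⇒x∧y≈x x≤z)))

  x≤⊥⇒x≈⊥ : ∀ {x} → x ≤ ⊥ → x ≈ ⊥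
  x≤⊥⇒x≈⊥ {x} x≤⊥ = trans (sym (∨-identityʳ x)) x≤⊥

  x≤⊤ : ∀ {x} → x ≤ ⊤
  x≤⊤ {x} = ∨-zeroʳ x

  x∧y≈⊥⇒x≤-y : ∀ {x y} → x ∧ y ≈ ⊥ → x ≤ - y
  x∧y≈⊥⇒x≤-y {x} {y} x∧y≈⊥ = x∧y≈x⇒x≤y (sym (begin-equality
    x                ≈⟨ ∧-identityʳ x ⟨
    x ∧ ⊤            ≈⟨ ∧-congˡ (∨-complementʳ y) ⟨
    x ∧ (y ∨ - y)    ≈⟨ ∧-distribˡ-∨ x y (- y) ⟩
    x ∧ y ∨ x ∧ - y  ≈⟨ ∨-congʳ x∧y≈⊥ ⟩
    ⊥ ∨ x ∧ - y      ≈⟨ ∨-identityˡ _ ⟩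
    x ∧ - y          ∎))

  ⨾-monoˡ : ∀ {x x′ y} → x ≤ x′ → x ⨾ y ≤ x′ ⨾ y
  ⨾-monoˡ {x} {x′} {y} x≤x′ = trans (sym (ax3ˡ x x′ y)) (⨾-cong x≤x′ refl)

  ⨾-monoʳ : ∀ {x y y′} → y ≤ y′ → x ⨾ y ≤ x ⨾ y′
  ⨾-monoʳ {x} {y} {y′} y≤y′ = trans (sym (ax3ʳ x y y′)) (⨾-cong refl y≤y′)

  ⨾-mono : ∀ {x x′ y y′} → x ≤ x′ → y ≤ y′ → x ⨾ y ≤ x′ ⨾ y′
  ⨾-mono x≤x′ y≤y′ = ≤-trans (⨾-monoˡ x≤x′) (⨾-monoʳ y≤y′)

  ⨾-zeroʳ : ∀ {x} → x ⨾ ⊥ ≈ ⊥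
  ⨾-zeroʳ = x≤⊥⇒x≈⊥ (≤-trans (⨾-monoˡ x≤⊤) (≤-reflexive ax4ˡ))

  ⨾-zeroˡ : ∀ {y} → ⊥ ⨾ y ≈ ⊥
  ⨾-zeroˡ = x≤⊥⇒x≈⊥ (≤-trans (⨾-monoʳ x≤⊤) (≤-reflexive ax4ʳ))

  ˘-zero : ⊥ ˘ ≈ ⊥
  ˘-zero = trans (˘-cong (sym (∧-zeroˡ (⊥ ˘)))) (trans (ax2 ⊥ ⊥) (∧-zeroʳ _))

  x˘˘≈⊤˘∧x : ∀ {x} → x ˘ ˘ ≈ ⊤ ˘ ∧ x
  x˘˘≈⊤˘∧x {x} = trans (˘-cong (sym (∧-identityˡ (x ˘)))) (ax2 ⊤ x)

  x≤⊤˘⇒x˘˘≈x : ∀ {x} → x ≤ ⊤ ˘ → x ˘ ˘ ≈ x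
  x≤⊤˘⇒x˘˘≈x x≤⊤˘ = trans x˘˘≈⊤˘∧x (trans (∧-comm _ _) (x≤y⇒x∧y≈x x≤⊤˘))

  x≤⊤˘⇒x˘≤⊤˘ : ∀ {x} → x ≤ ⊤ ˘ → x ˘ ≤ ⊤ ˘
  x≤⊤˘⇒x˘≤⊤˘ {x} x≤⊤˘ = begin
    x ˘          ≈⟨ ˘-cong (x≤⊤˘⇒x˘˘≈x x≤⊤˘) ⟨
    x ˘ ˘ ˘      ≈⟨ x˘˘≈⊤˘∧x ⟩
    ⊤ ˘ ∧ x ˘    ≤⟨ x∧y≤x ⟩
    ⊤ ˘          ∎

  x∧⊤˘≈⊥⇒x˘≈⊥ : ∀ {x} → x ∧ ⊤ ˘ ≈ ⊥ → x ˘ ≈ ⊥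
  x∧⊤˘≈⊥⇒x˘≈⊥ {x} x∧⊤˘≈⊥ = begin-equality
    x ˘            ≈⟨ ∧-identityʳ _ ⟨
    x ˘ ∧ ⊤        ≈⟨ ax2 x ⊤ ⟨
    (x ∧ ⊤ ˘) ˘    ≈⟨ ˘-cong x∧⊤˘≈⊥ ⟩
    ⊥ ˘            ≈⟨ ˘-zero ⟩
    ⊥              ∎

  ˘-mono : ConvCompletelyAdditive → ∀ {x y} → x ≤ y → x ˘ ≤ y ˘
  ˘-mono additive {x} {y} x≤y =
    proj₁ (additive Below y y-isLub) (x ˘) (x , lift x≤y , refl)
    where
    Below : Carrier → Set _
    Below z = Lift o (z ≤ y)
    y-isLub : IsLub Below y
    y-isLub = (λ { _ (lift z≤y) → z≤y }) , (λ _ bounds → bounds y (lift (∨-idem y)))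

  modularˡ : ∀ {x y z} → x ≤ ⊤ ˘ → (x ⨾ y) ∧ z ≈ (x ⨾ (y ∧ (x ˘ ⨾ z))) ∧ z
  modularˡ {x} {y} {z} x≤⊤˘ = begin-equality
    (x ⨾ y) ∧ z                              ≈⟨ ∧-congʳ (⨾-cong x˘˘≈x refl) ⟨
    (x ˘ ˘ ⨾ y) ∧ z                          ≈⟨ ax5ˡ (x ˘) y z ⟩
    (x ˘ ˘ ⨾ (y ∧ (x ˘ ˘ ˘ ⨾ z))) ∧ z        ≈⟨ ∧-congʳ (⨾-cong x˘˘≈x
                                                  (∧-congˡ (⨾-cong (˘-cong x˘˘≈x) refl))) ⟩
    (x ⨾ (y ∧ (x ˘ ⨾ z))) ∧ z                ∎
    where x˘˘≈x = x≤⊤˘⇒x˘˘≈x x≤⊤˘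

  modularʳ : ∀ {x y z} → y ≤ ⊤ ˘ → (x ⨾ y) ∧ z ≈ ((x ∧ (z ⨾ y ˘)) ⨾ y) ∧ z
  modularʳ {x} {y} {z} y≤⊤˘ = begin-equality
    (x ⨾ y) ∧ z                              ≈⟨ ∧-congʳ (⨾-cong refl y˘˘≈y) ⟨
    (x ⨾ y ˘ ˘) ∧ z                          ≈⟨ ax5ʳ x (y ˘) z ⟩
    ((x ∧ (z ⨾ y ˘ ˘ ˘)) ⨾ y ˘ ˘) ∧ z        ≈⟨ ∧-congʳ (⨾-cong
                                                  (∧-congˡ (⨾-cong refl (˘-cong y˘˘≈y))) y˘˘≈y) ⟩
    ((x ∧ (z ⨾ y ˘)) ⨾ y) ∧ z                ∎
    where y˘˘≈y = x≤⊤˘⇒x˘˘≈x y≤⊤˘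

  atom-≤ : ∀ {a x} → Atom a → ¬ x ≈ ⊥ → x ≤ a → x ≈ a
  atom-≤ (_ , below-a) x≉⊥ x≤a with below-a _ x≤a
  ... | inj₁ x≈⊥ = ⊥-elim (x≉⊥ x≈⊥)
  ... | inj₂ x≈a = x≈a

  atom-∧ : ∀ {a} → Atom a → ∀ w → a ∧ w ≈ ⊥ ⊎ a ≤ w
  atom-∧ {a} (_ , below-a) w with below-a (a ∧ w) x∧y≤x
  ... | inj₁ a∧w≈⊥ = inj₁ a∧w≈⊥
  ... | inj₂ a∧w≈a = inj₂ (x∧y≈x⇒x≤y a∧w≈a)

  atom-˘≉⊥⇒≤⊤˘ : ∀ {a} → Atom a → ¬ a ˘ ≈ ⊥ → a ≤ ⊤ ˘
  atom-˘≉⊥⇒≤⊤˘ atom-a a˘≉⊥ with atom-∧ atom-a (⊤ ˘)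
  ... | inj₁ a∧⊤˘≈⊥ = ⊥-elim (a˘≉⊥ (x∧⊤˘≈⊥⇒x˘≈⊥ a∧⊤˘≈⊥))
  ... | inj₂ a≤⊤˘ = a≤⊤˘

  atom-˘ : ConvCompletelyAdditive → ∀ {a} → Atom a → a ≤ ⊤ ˘ → Atom (a ˘)
  atom-˘ additive {a} (a≉⊥ , below-a) a≤⊤˘ = a˘≉⊥ , below-a˘
    where
    a˘˘≈a = x≤⊤˘⇒x˘˘≈x a≤⊤˘
    a˘≉⊥ : ¬ a ˘ ≈ ⊥
    a˘≉⊥ a˘≈⊥ = a≉⊥ (trans (sym a˘˘≈a) (trans (˘-cong a˘≈⊥) ˘-zero))
    x≤a˘⇒x˘˘≈x : ∀ {x} → x ≤ a ˘ → x ˘ ˘ ≈ x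
    x≤a˘⇒x˘˘≈x x≤a˘ = x≤⊤˘⇒x˘˘≈x (≤-trans x≤a˘ (x≤⊤˘⇒x˘≤⊤˘ a≤⊤˘))
    below-a˘ : ∀ x → x ≤ a ˘ → x ≈ ⊥ ⊎ x ≈ a ˘
    below-a˘ x x≤a˘ with below-a (x ˘) (≤-trans (˘-mono additive x≤a˘) (≤-reflexive a˘˘≈a))
    ... | inj₁ x˘≈⊥ = inj₁ (trans (sym (x≤a˘⇒x˘˘≈x x≤a˘)) (trans (˘-cong x˘≈⊥) ˘-zero))
    ... | inj₂ x˘≈a = inj₂ (trans (sym (x≤a˘⇒x˘˘≈x x≤a˘)) (˘-cong x˘≈a))

  cycleˡ : ∀ {x y z} → x ≤ ⊤ ˘ → Atom y → ¬ z ≈ ⊥ → z ≤ x ⨾ y → y ≤ x ˘ ⨾ z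
  cycleˡ {x} {y} {z} x≤⊤˘ atom-y z≉⊥ z≤x⨾y with atom-∧ atom-y (x ˘ ⨾ z)
  ... | inj₂ y≤x˘⨾z = y≤x˘⨾z
  ... | inj₁ disjoint = ⊥-elim (z≉⊥ (begin-equality
    z                              ≈⟨ trans (∧-comm _ _) (x≤y⇒x∧y≈x z≤x⨾y) ⟨
    (x ⨾ y) ∧ z                    ≈⟨ modularˡ x≤⊤˘ ⟩
    (x ⨾ (y ∧ (x ˘ ⨾ z))) ∧ z      ≈⟨ ∧-congʳ (trans (⨾-cong refl disjoint) ⨾-zeroʳ) ⟩
    ⊥ ∧ z                          ≈⟨ ∧-zeroˡ z ⟩
    ⊥                              ∎))

  cycleʳ : ∀ {x y z} → y ≤ ⊤ ˘ → Atom x → ¬ z ≈ ⊥ → z ≤ x ⨾ y → x ≤ z ⨾ y ˘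
  cycleʳ {x} {y} {z} y≤⊤˘ atom-x z≉⊥ z≤x⨾y with atom-∧ atom-x (z ⨾ y ˘)
  ... | inj₂ x≤z⨾y˘ = x≤z⨾y˘
  ... | inj₁ disjoint = ⊥-elim (z≉⊥ (begin-equality
    z                              ≈⟨ trans (∧-comm _ _) (x≤y⇒x∧y≈x z≤x⨾y) ⟨
    (x ⨾ y) ∧ z                    ≈⟨ modularʳ y≤⊤˘ ⟩
    ((x ∧ (z ⨾ y ˘)) ⨾ y) ∧ z      ≈⟨ ∧-congʳ (trans (⨾-cong disjoint refl) ⨾-zeroˡ) ⟩
    ⊥ ∧ z                          ≈⟨ ∧-zeroˡ z ⟩
    ⊥                              ∎))

  atom-≤-˘⇒˘-pair : ConvCompletelyAdditive → ∀ {b c} → Atom b → Atom c →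
                     b ≤ ⊤ ˘ → c ≤ b ˘ → b ≈ c ˘ × c ≈ b ˘
  atom-≤-˘⇒˘-pair additive atom-b (c≉⊥ , _) b≤⊤˘ c≤b˘ =
    trans (sym (x≤⊤˘⇒x˘˘≈x b≤⊤˘)) (˘-cong (sym c≈b˘)) , c≈b˘
    where c≈b˘ = atom-≤ (atom-˘ additive atom-b b≤⊤˘) c≉⊥ c≤b˘

  ≤𝟏'⇒factors-converse : ConvCompletelyAdditive → ∀ {a b c} → Atom a → Atom b → Atom c →
                          a ≤ b ⨾ c → a ≤ 𝟏' → b ≈ c ˘ × c ≈ b ˘
  ≤𝟏'⇒factors-converse additive {a} {b} {c} (a≉⊥ , _) atom-b atom-c a≤b⨾c a≤𝟏'
    with atom-∧ atom-b (⊤ ˘) | atom-∧ atom-c (⊤ ˘)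
  ... | inj₂ b≤⊤˘ | _ = atom-≤-˘⇒˘-pair additive atom-b atom-c b≤⊤˘ (begin
    c          ≤⟨ cycleˡ b≤⊤˘ atom-c a≉⊥ a≤b⨾c ⟩
    b ˘ ⨾ a    ≤⟨ ⨾-monoʳ a≤𝟏' ⟩
    b ˘ ⨾ 𝟏'   ≤⟨ ax6ʳ (b ˘) ⟩
    b ˘        ∎)
  ... | inj₁ _ | inj₂ c≤⊤˘ = swap (atom-≤-˘⇒˘-pair additive atom-c atom-b c≤⊤˘ (begin
    b          ≤⟨ cycleʳ c≤⊤˘ atom-b a≉⊥ a≤b⨾c ⟩
    a ⨾ c ˘    ≤⟨ ⨾-monoˡ a≤𝟏' ⟩
    𝟏' ⨾ c ˘   ≤⟨ ax6ˡ (c ˘) ⟩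
    c ˘        ∎))
  ... | inj₁ b∧⊤˘≈⊥ | inj₁ c∧⊤˘≈⊥ = ⊥-elim (a≉⊥ (x≤⊥⇒x≈⊥ (begin
    a                           ≤⟨ ∧-greatest (≤-trans a≤b⨾c b⨾c≤-⊤˘⨾-⊤˘) a≤𝟏' ⟩
    (- (⊤ ˘) ⨾ - (⊤ ˘)) ∧ 𝟏'    ≈⟨ ax8 ⟩
    ⊥                           ∎)))
    where b⨾c≤-⊤˘⨾-⊤˘ = ⨾-mono (x∧y≈⊥⇒x≤-y b∧⊤˘≈⊥) (x∧y≈⊥⇒x≤-y c∧⊤˘≈⊥)

lemma2p7 : ∀ {o ℓ} (𝔄 : REL o ℓ) → let open REL 𝔄 in
    Perfect → ∀ a b c → Atom a → Atom b → Atom c → a ≤ b ⨾ c →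
      ((a ≤ 𝟏' → (b ≈ c ˘) × (c ≈ b ˘))
      × (¬ (b ˘ ≈ ⊥) → c ≤ b ˘ ⨾ a)
      × (¬ (c ˘ ≈ ⊥) → b ≤ a ⨾ c ˘)
      × (¬ (a ˘ ≈ ⊥) → ¬ (b ˘ ≈ ⊥) → b ˘ ≤ c ⨾ a ˘)
      × (¬ (a ˘ ≈ ⊥) → ¬ (c ˘ ≈ ⊥) → c ˘ ≤ a ˘ ⨾ b)
      × (¬ (a ˘ ≈ ⊥) → ¬ (b ˘ ≈ ⊥) → ¬ (c ˘ ≈ ⊥) → a ˘ ≤ c ˘ ⨾ b ˘))
lemma2p7 𝔄 (_ , _ , additive , _) a b c atom-a atom-b atom-c a≤b⨾c =
    ≤𝟏'⇒factors-converse additive atom-a atom-b atom-c a≤b⨾c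
  , c≤b˘⨾a , b≤a⨾c˘ , b˘≤c⨾a˘ , c˘≤a˘⨾b , a˘≤c˘⨾b˘
  where
  open REL 𝔄
  open Properties 𝔄
  atom-˘′ : ∀ {x} → Atom x → ¬ x ˘ ≈ ⊥ → Atom (x ˘)
  atom-˘′ atom-x x˘≉⊥ = atom-˘ additive atom-x (atom-˘≉⊥⇒≤⊤˘ atom-x x˘≉⊥)
  c≤b˘⨾a : ¬ b ˘ ≈ ⊥ → c ≤ b ˘ ⨾ a
  c≤b˘⨾a b˘≉⊥ = cycleˡ (atom-˘≉⊥⇒≤⊤˘ atom-b b˘≉⊥) atom-c (proj₁ atom-a) a≤b⨾c
  b≤a⨾c˘ : ¬ c ˘ ≈ ⊥ → b ≤ a ⨾ c ˘
  b≤a⨾c˘ c˘≉⊥ = cycleʳ (atom-˘≉⊥⇒≤⊤˘ atom-c c˘≉⊥) atom-b (proj₁ atom-a) a≤b⨾c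
  b˘≤c⨾a˘ : ¬ a ˘ ≈ ⊥ → ¬ b ˘ ≈ ⊥ → b ˘ ≤ c ⨾ a ˘
  b˘≤c⨾a˘ a˘≉⊥ b˘≉⊥ =
    cycleʳ (atom-˘≉⊥⇒≤⊤˘ atom-a a˘≉⊥) (atom-˘′ atom-b b˘≉⊥) (proj₁ atom-c) (c≤b˘⨾a b˘≉⊥)
  c˘≤a˘⨾b : ¬ a ˘ ≈ ⊥ → ¬ c ˘ ≈ ⊥ → c ˘ ≤ a ˘ ⨾ b
  c˘≤a˘⨾b a˘≉⊥ c˘≉⊥ =
    cycleˡ (atom-˘≉⊥⇒≤⊤˘ atom-a a˘≉⊥) (atom-˘′ atom-c c˘≉⊥) (proj₁ atom-b) (b≤a⨾c˘ c˘≉⊥)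
  a˘≤c˘⨾b˘ : ¬ a ˘ ≈ ⊥ → ¬ b ˘ ≈ ⊥ → ¬ c ˘ ≈ ⊥ → a ˘ ≤ c ˘ ⨾ b ˘
  a˘≤c˘⨾b˘ a˘≉⊥ b˘≉⊥ c˘≉⊥ =
    cycleˡ (atom-˘≉⊥⇒≤⊤˘ atom-c c˘≉⊥) (atom-˘′ atom-a a˘≉⊥) b˘≉⊥ (b˘≤c⨾a˘ a˘≉⊥ b˘≉⊥)
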